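{- Let $\mathbf{C}^\exists$ be the natural deduction system described in the context. Every deduction in $\mathbf{C}^\exists$ in normal form has the subformula property: every formula occurring in it is a subformula of its conclusion or of one of its undischarged assumptions, where the subformulas of $\exists x A$ include $\exists xA$ and all subformulas of all substitution instances $A^x_t$.
   Context: The language is first-order: terms built from parameters $a,b,c,\dots$ (playing the role of free variables), constants and function symbols; formulas built from predicate symbols applied to terms by $\neg$ (unary), $\supset$, $\land$, $\lor$ and $\exists x$, where bound variables $x,y,z,\dots$ are distinct from parameters and never occur free. $A^x_t$ denotes the result of substituting the term $t$ for the variable $x$ in $A$ ($t$ free for $x$). Deductions are trees of formula occurrences whose leaves are assumptions; each assumption belongs to a numbered assumption class, and a rule discharging class $i$ (written $[X]^i$) discharges all assumptions of that class above the indicated premise. A single assumption $A$ is a deduction of $A$ from $A$. Rules of $\mathbf{C}^\exists$ ($C$ arbitrary): $\land I$: from $A$, $B$, and a deduction of $C$ from $[A\land B]$, infer $C$. $\land E$: from $A\land B$ and a deduction of $C$ from $[A]$, $[B]$, infer $C$. $\lor I$: from $A$ (or from $B$) and a deduction of $C$ from $[A\lor B]$, infer $C$. $\lor E$: from $A\lor B$, a deduction of $C$ from $[A]$, and a deduction of $C$ from $[B]$, infer $C$. $\supset I$: from $B$ and a deduction of $C$ from $[A\supset B]$, infer $C$. $TR$ (an introduction rule for $\supset$): from a deduction of $C$ from $[A]$ and a deduction of $C$ from $[A\supset B]$, infer $C$. $\supset E$: from $A\supset B$, $A$, and a deduction of $C$ from $[B]$, infer $C$. $\neg I$: from a deduction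 of $C$ from $[A]$ and a deduction of $C$ from $[\neg A]$, infer $C$. $\neg E$: from $\neg A$ and $A$, infer $C$. $\exists I$: from $A^x_t$ and a deduction of $C$ from $[\exists x A]$, infer $C$. $\exists E$: from $\exists x A$ and a deduction of $C$ from $[A^x_a]$, infer $C$, provided the parameter $a$ does not occur in $\exists xA$, in $C$, or in any undischarged assumption of the deduction of $C$ other than those of the discharged class $[A^x_a]$. Introduction rules: $\land I,\lor I,\supset I,TR,\neg I,\exists I$; elimination rules: $\land E,\lor E,\supset E,\neg E,\exists E$. In elimination rules $A\land B, A\lor B, A\supset B,\neg A,\exists xA$ are the major premises; premises in the place of $C$ (in any rule) are arbitrary premises; the discharged $A\land B$, $A\lor B$, $A\supset B$ (in $\supset I$ and $TR$), $\neg A$ (in $\neg I$), $\exists xA$ (in $\exists I$) are the major assumptions discharged by the introduction rule. Convention: there is no vacuous discharge above arbitrary premises (every discharge in a rule application above an arbitrary premise discharges at least one assumption occurrence, except that $\land E$ may discharge only one of $A$, $B$). A maximal formula is an occurrence of a formula with main operator $\ast$ that is both the major premise of an application of $\ast E$ and the major assumption discharged by an application of $\ast I$ (or of $TR$ when $\ast$ is $\supset$). A segment is a sequence $C_1,\dots,C_n$ of occurrences of the same formula such that for all $i<n$, $C_i$ is an arbitrary premise of a rule application whose conclusion is $C_{i+1}$, $C_n$ is not an arbitrary premise of any rule application, and either $n>1$, or $n\ge 1$ and $C_1$ is the conclusion of an application of $\neg E$. A maximal segment is a segment whose last formula is the major premise of an elimination rule. A deduction is in normal form if it contains neither maximal formulas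 nor maximal segments. -}

module Defs where

open import Data.Nat using (ℕ; zero; suc; _<_)
open import Data.Fin using (Fin; zero; suc; _≟_; punchOut)
open import Data.Vec using (Vec; []; _∷_)
open import Data.List using (List; []; _∷_; map; _++_)
open import Data.List.Membership.Propositional using (_∈_)
open import Data.Maybe using (Maybe; just; nothing)
open import Data.Bool using (Bool; true; false)
open import Data.Product using (Σ; _×_; _,_; proj₁)
open import Data.Sum using (_⊎_)
open import Data.Unit using (⊤)
open import Relation.Binary.PropositionalEquality using (_≡_; _≢_)
open import Relation.Nullary using (¬_; yes; no)

-- A first-order signature: function symbols (constants = 0-ary function
-- symbols) and predicate symbols, each with an arity.
record Signature : Set₁ where
  field
    Fun       : Set
    funArity  : Fun → ℕ
    Pred      : Set
    predArity : Pred → ℕ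

module ND (S : Signature) where
  open Signature S

  -- Bound variables are de Bruijn indices: Term n / Formula n
  -- have n bound variables in scope.  Parameters a₀,a₁,… are 'par k'.

  data Term (n : ℕ) : Set where
    var : Fin n → Term n
    par : ℕ → Term n
    fun : (f : Fun) → Vec (Term n) (funArity f) → Term n

  infixr 6 _⊃_
  infixr 7 _∨_
  infixr 8 _∧_
  data Formula (n : ℕ) : Set where
    atom : (P : Pred) → Vec (Term n) (predArity P) → Formula n
    ¬'_  : Formula n → Formula n
    _⊃_ _∧_ _∨_ : Formula n → Formula n → Formula n
    ∃'   : Formula (suc n) → Formula n      -- ∃x A, A has x as index 0

  Fm : Set
  Fm = Formula 0

  embed  : ∀ {n} → Term 0 → Term n
  embeds : ∀ {n m} → Vec (Term 0) m → Vec (Term n) m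
  embed (par a) = par a
  embed (fun f ts) = fun f (embeds ts)
  embeds [] = []
  embeds (t ∷ ts) = embed t ∷ embeds ts

  substT  : ∀ {n} → Fin (suc n) → Term 0 → Term (suc n) → Term n
  substTs : ∀ {n m} → Fin (suc n) → Term 0 → Vec (Term (suc n)) m → Vec (Term n) m
  substT k t (var j) with k ≟ j
  ... | yes _  = embed t
  ... | no k≢j = var (punchOut k≢j)
  substT k t (par a) = par a
  substT k t (fun f ts) = fun f (substTs k t ts)
  substTs k t [] = []
  substTs k t (s ∷ ss) = substT k t s ∷ substTs k t ss

  substF : ∀ {n} → Fin (suc n) → Term 0 → Formula (suc n) → Formula n
  substF k t (atom P ts) = atom P (substTs k t ts)
  substF k t (¬' A)  = ¬' substF k t A
  substF k t (A ⊃ B) = substF k t A ⊃ substF k t B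
  substF k t (A ∧ B) = substF k t A ∧ substF k t B
  substF k t (A ∨ B) = substF k t A ∨ substF k t B
  substF k t (∃' A)  = ∃' (substF (suc k) t A)

  -- A [ t ]  is  A^x_t  for  ∃x A = ∃' A
  _[_] : Formula 1 → Term 0 → Fm
  A [ t ] = substF zero t A

  parsT  : ∀ {n} → Term n → List ℕ
  parsTs : ∀ {n m} → Vec (Term n) m → List ℕ
  parsT (var _) = []
  parsT (par a) = a ∷ []
  parsT (fun f ts) = parsTs ts
  parsTs [] = []
  parsTs (t ∷ ts) = parsT t ++ parsTs ts

  parsF : ∀ {n} → Formula n → List ℕ
  parsF (atom P ts) = parsTs ts
  parsF (¬' A)  = parsF A
  parsF (A ⊃ B) = parsF A ++ parsF B
  parsF (A ∧ B) = parsF A ++ parsF B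
  parsF (A ∨ B) = parsF A ++ parsF B
  parsF (∃' A)  = parsF A

  data Sub : Fm → Fm → Set where
    sub-refl : ∀ {G} → Sub G G
    sub-¬    : ∀ {F A} → Sub F A → Sub F (¬' A)
    sub-⊃ˡ   : ∀ {F A B} → Sub F A → Sub F (A ⊃ B)
    sub-⊃ʳ   : ∀ {F A B} → Sub F B → Sub F (A ⊃ B)
    sub-∧ˡ   : ∀ {F A B} → Sub F A → Sub F (A ∧ B)
    sub-∧ʳ   : ∀ {F A B} → Sub F B → Sub F (A ∧ B)
    sub-∨ˡ   : ∀ {F A B} → Sub F A → Sub F (A ∨ B)
    sub-∨ʳ   : ∀ {F A B} → Sub F B → Sub F (A ∨ B)
    sub-∃    : ∀ {F A} (t : Term 0) → Sub F (A [ t ]) → Sub F (∃' A)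

  -- Raw deductions of C^∃, indexed by their conclusion.  Natural numbers
  -- i, j are assumption classes; the comments list the discharges.

  data Ded : Fm → Set where
    assume : (i : ℕ) (A : Fm) → Ded A
    -- A, B, [A∧B]^i C / C
    ∧I : ∀ {A B C} (i : ℕ) → Ded A → Ded B → Ded C → Ded C
    -- A∧B, [A]^i [B]^j C / C
    ∧E : ∀ {A B C} (i j : ℕ) → Ded (A ∧ B) → Ded C → Ded C
    -- A, [A∨B]^i C / C
    ∨I₁ : ∀ {A C} (B : Fm) (i : ℕ) → Ded A → Ded C → Ded C
    -- B, [A∨B]^i C / C
    ∨I₂ : ∀ {B C} (A : Fm) (i : ℕ) → Ded B → Ded C → Ded C
    -- A∨B, [A]^i C, [B]^j C / C
    ∨E : ∀ {A B C} (i j : ℕ) → Ded (A ∨ B) → Ded C → Ded C → Ded C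
    -- B, [A⊃B]^i C / C
    ⊃I : ∀ {B C} (A : Fm) (i : ℕ) → Ded B → Ded C → Ded C
    -- [A]^i C, [A⊃B]^j C / C
    TR : ∀ {C} (A B : Fm) (i j : ℕ) → Ded C → Ded C → Ded C
    -- A⊃B, A, [B]^i C / C
    ⊃E : ∀ {A B C} (i : ℕ) → Ded (A ⊃ B) → Ded A → Ded C → Ded C
    -- [A]^i C, [¬A]^j C / C
    ¬I : ∀ {C} (A : Fm) (i j : ℕ) → Ded C → Ded C → Ded C
    -- ¬A, A / C
    ¬E : ∀ {A} (C : Fm) → Ded (¬' A) → Ded A → Ded C
    -- A^x_t, [∃xA]^i C / C
    ∃I : ∀ {C} (A : Formula 1) (t : Term 0) (i : ℕ) → Ded (A [ t ]) → Ded C → Ded C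
    -- ∃xA, [A^x_a]^i C / C   (eigenvariable condition in WF)
    ∃E : ∀ {A C} (a i : ℕ) → Ded (∃' A) → Ded C → Ded C

  -- Premises of a rule application: the subdeduction, whether it is an
  -- arbitrary premise (in the place of C), the classes (with their
  -- formulas) discharged above it, and the class of the major assumption
  -- discharged above it by an introduction rule (if any).
  record Prem : Set where
    constructor prem
    field
      fm        : Fm
      sub       : Ded fm
      arbitrary : Bool
      disch     : List (ℕ × Fm)
      majorAss  : Maybe ℕ
  open Prem public

  premisesOf : ∀ {C} → Ded C → List Prem
  premisesOf (assume i A) = []
  premisesOf (∧I {A} {B} i d₁ d₂ d₃) =
    prem _ d₁ false [] nothing ∷ prem _ d₂ false [] nothing ∷
    prem _ d₃ true ((i , A ∧ B) ∷ []) (just i) ∷ []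
  premisesOf (∧E {A} {B} i j d₁ d₂) =
    prem _ d₁ false [] nothing ∷ prem _ d₂ true ((i , A) ∷ (j , B) ∷ []) nothing ∷ []
  premisesOf (∨I₁ {A} B i d₁ d₂) =
    prem _ d₁ false [] nothing ∷ prem _ d₂ true ((i , A ∨ B) ∷ []) (just i) ∷ []
  premisesOf (∨I₂ {B} A i d₁ d₂) =
    prem _ d₁ false [] nothing ∷ prem _ d₂ true ((i , A ∨ B) ∷ []) (just i) ∷ []
  premisesOf (∨E {A} {B} i j d₁ d₂ d₃) =
    prem _ d₁ false [] nothing ∷ prem _ d₂ true ((i , A) ∷ []) nothing ∷
    prem _ d₃ true ((j , B) ∷ []) nothing ∷ []
  premisesOf (⊃I {B} A i d₁ d₂) =
    prem _ d₁ false [] nothing ∷ prem _ d₂ true ((i , A ⊃ B) ∷ []) (just i) ∷ []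
  premisesOf (TR A B i j d₁ d₂) =
    prem _ d₁ true ((i , A) ∷ []) nothing ∷ prem _ d₂ true ((j , A ⊃ B) ∷ []) (just j) ∷ []
  premisesOf (⊃E {A} {B} i d₁ d₂ d₃) =
    prem _ d₁ false [] nothing ∷ prem _ d₂ false [] nothing ∷
    prem _ d₃ true ((i , B) ∷ []) nothing ∷ []
  premisesOf (¬I A i j d₁ d₂) =
    prem _ d₁ true ((i , A) ∷ []) nothing ∷ prem _ d₂ true ((j , ¬' A) ∷ []) (just j) ∷ []
  premisesOf (¬E C d₁ d₂) =
    prem _ d₁ false [] nothing ∷ prem _ d₂ false [] nothing ∷ []
  premisesOf (∃I A t i d₁ d₂) =
    prem _ d₁ false [] nothing ∷ prem _ d₂ true ((i , ∃' A) ∷ []) (just i) ∷ []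
  premisesOf (∃E {A} a i d₁ d₂) =
    prem _ d₁ false [] nothing ∷ prem _ d₂ true ((i , A [ par a ]) ∷ []) nothing ∷ []

  majorPremise : ∀ {C} → Ded C → Maybe (Σ Fm Ded)
  majorPremise (∧E i j d₁ d₂)     = just (_ , d₁)
  majorPremise (∨E i j d₁ d₂ d₃)  = just (_ , d₁)
  majorPremise (⊃E i d₁ d₂ d₃)    = just (_ , d₁)
  majorPremise (¬E C d₁ d₂)       = just (_ , d₁)
  majorPremise (∃E a i d₁ d₂)     = just (_ , d₁)
  majorPremise _                  = nothing

  Discharges : Prem → ℕ → Set
  Discharges p i = i ∈ map proj₁ (disch p)

  data Open : ∀ {C} → Ded C → ℕ → Fm → Set where
    open-assume : ∀ i A → Open (assume i A) i A
    open-prem   : ∀ {C} {d : Ded C} {i F} (p : Prem) → p ∈ premisesOf d →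
                  ¬ Discharges p i → Open (sub p) i F → Open d i F

  Consistent : ∀ {C} → Ded C → Set
  Consistent d = ∀ p → p ∈ premisesOf d → ∀ i F → (i , F) ∈ disch p →
                 ∀ G → Open (sub p) i G → G ≡ F

  -- no vacuous discharge (∧E may discharge only one of A, B)
  NonVacuous : ∀ {C} → Ded C → Set
  NonVacuous (∧E {A} {B} i j d₁ d₂) = Open d₂ i A ⊎ Open d₂ j B
  NonVacuous d = ∀ p → p ∈ premisesOf d → ∀ i F → (i , F) ∈ disch p →
                 Open (sub p) i F

  Eigen : ∀ {C} → Ded C → Set
  Eigen (∃E {A} {C} a i d₁ d₂) =
    ¬ (a ∈ parsF (∃' A)) × ¬ (a ∈ parsF C) ×
    (∀ k G → Open d₂ k G → k ≢ i → ¬ (a ∈ parsF G))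
  Eigen _ = ⊤

  data WF : ∀ {C} → Ded C → Set where
    wf : ∀ {C} {d : Ded C} → (∀ p → p ∈ premisesOf d → WF (sub p)) →
         Consistent d → NonVacuous d → Eigen d → WF d

  -- e ⊑ d : e is (the subdeduction above) a formula occurrence in d
  data _⊑_ : ∀ {A B} → Ded A → Ded B → Set where
    ⊑-refl : ∀ {A} {d : Ded A} → d ⊑ d
    ⊑-prem : ∀ {A B} {e : Ded A} {d : Ded B} (p : Prem) →
             p ∈ premisesOf d → e ⊑ sub p → e ⊑ d

  data OpenMajorAss : ∀ {C} → Ded C → ℕ → Set where
    here  : ∀ {C} {d : Ded C} {j F} → majorPremise d ≡ just (F , assume j F) →
            OpenMajorAss d j
    there : ∀ {C} {d : Ded C} {j} (p : Prem) → p ∈ premisesOf d →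
            ¬ Discharges p j → OpenMajorAss (sub p) j → OpenMajorAss d j

  -- a maximal formula: major premise of ∗E that is the major assumption
  -- discharged by ∗I (or TR)
  data HasMaximalFormula {C} (d : Ded C) : Set where
    maxf : ∀ {E} (e : Ded E) (p : Prem) (j : ℕ) → e ⊑ d → p ∈ premisesOf e →
           majorAss p ≡ just j → OpenMajorAss (sub p) j → HasMaximalFormula d

  -- Chain d n e : occurrences C_n (root of d), …, C_1 (root of e), each
  -- C_i (i < n) an arbitrary premise of the rule with conclusion C_{i+1}
  data Chain : ∀ {A B} → Ded A → ℕ → Ded B → Set where
    one  : ∀ {A} {d : Ded A} → Chain d 1 d
    step : ∀ {A B n} {d : Ded A} {e : Ded B} (p : Prem) → p ∈ premisesOf d →
           arbitrary p ≡ true → Chain (sub p) n e → Chain d (suc n) e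

  data IsNegE : ∀ {C} → Ded C → Set where
    isNegE : ∀ {A} C (d₁ : Ded (¬' A)) (d₂ : Ded A) → IsNegE (¬E C d₁ d₂)

  SegmentEndingAt : ∀ {C} → Ded C → Set
  SegmentEndingAt m = Σ ℕ λ n → Σ Fm λ B → Σ (Ded B) λ e →
                      Chain m n e × (1 < n ⊎ IsNegE e)

  data HasMaximalSegment {C} (d : Ded C) : Set where
    maxs : ∀ {E F} (e : Ded E) (m : Ded F) → e ⊑ d →
           majorPremise e ≡ just (F , m) → SegmentEndingAt m →
           HasMaximalSegment d

  Normal : ∀ {C} → Ded C → Set
  Normal d = ¬ HasMaximalFormula d × ¬ HasMaximalSegment d

{-# OPTIONS --safe #-}
module Submission where

-- In a normal deduction every formula is a subformula of the conclusion or of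
-- an open assumption that is the major premise of an elimination.  At the root
-- inference all premises and discharged assumptions are subformulas of the
-- conclusion or of a principal formula P.  For an elimination, P is the major
-- premise, which normality forces to be an assumption.  For an introduction, P
-- is the discharged major assumption; normality says its class never stands as
-- a major premise, so the induction hypothesis for the premise above bounds P
-- by the conclusion or by some other, still open, major assumption.

open import Defs
open import Data.Nat using (ℕ) renaming (_≟_ to _≟ℕ_)
open import Data.Nat.Properties using (n<1+n)
open import Data.Product using (Σ; _×_; _,_; proj₁; proj₂)
open import Data.Sum using (_⊎_; inj₁; inj₂; map₂)
open import Data.Empty using (⊥-elim)
open import Data.List using ([]; _∷_; map)
open import Data.List.Relation.Unary.All using (All; []; _∷_; lookup)
open import Data.List.Relation.Unary.Any using (here; there)
open import Data.List.Membership.Propositional using (_∈_)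
open import Data.List.Membership.Propositional.Properties using (∈-map⁻)
open import Data.List.Membership.DecPropositional _≟ℕ_ using (_∈?_)
open import Data.Maybe using (just; nothing)
open import Data.Bool using (true; false)
open import Relation.Binary.PropositionalEquality using (_≡_; refl; subst)
open import Relation.Nullary using (¬_; yes; no)

module SubformulaProperty (S : Signature) where
  open ND S

  sub-trans : ∀ {F G H} → Sub F G → Sub G H → Sub F H
  sub-trans f sub-refl    = f
  sub-trans f (sub-¬ g)   = sub-¬ (sub-trans f g)
  sub-trans f (sub-⊃ˡ g)  = sub-⊃ˡ (sub-trans f g)
  sub-trans f (sub-⊃ʳ g)  = sub-⊃ʳ (sub-trans f g)
  sub-trans f (sub-∧ˡ g)  = sub-∧ˡ (sub-trans f g)
  sub-trans f (sub-∧ʳ g)  = sub-∧ʳ (sub-trans f g)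
  sub-trans f (sub-∨ˡ g)  = sub-∨ˡ (sub-trans f g)
  sub-trans f (sub-∨ʳ g)  = sub-∨ʳ (sub-trans f g)
  sub-trans f (sub-∃ t g) = sub-∃ t (sub-trans f g)

  open⇒⊑ : ∀ {C i A} {d : Ded C} → Open d i A → assume i A ⊑ d
  open⇒⊑ (open-assume i A)     = ⊑-refl
  open⇒⊑ (open-prem p mem _ o) = ⊑-prem p mem (open⇒⊑ o)

  normal-premise : ∀ {C p} {s : Ded C} → Normal s → p ∈ premisesOf s → Normal (sub p)
  normal-premise (noMaxF , noMaxS) mem =
    (λ { (maxf e q j e⊑ q∈ eq om) → noMaxF (maxf e q j (⊑-prem _ mem e⊑) q∈ eq om) }) ,
    (λ { (maxs e m e⊑ eq seg)     → noMaxS (maxs e m (⊑-prem _ mem e⊑) eq seg) })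

  segment-via-arbitrary : ∀ {C B dis ma} {d : Ded C} {e : Ded B} →
                          prem B e true dis ma ∈ premisesOf d → SegmentEndingAt d
  segment-via-arbitrary {e = e} mem = 2 , _ , e , step _ mem refl one , inj₁ (n<1+n 1)

  assumption⊎segment : ∀ {C} (d : Ded C) → (Σ ℕ λ i → d ≡ assume i C) ⊎ SegmentEndingAt d
  assumption⊎segment (assume i A)         = inj₁ (i , refl)
  assumption⊎segment (¬E C d₁ d₂)         = inj₂ (1 , _ , _ , one , inj₂ (isNegE C d₁ d₂))
  assumption⊎segment (∧I i d₁ d₂ d₃)      = inj₂ (segment-via-arbitrary (there (there (here refl))))
  assumption⊎segment (∧E i j d₁ d₂)       = inj₂ (segment-via-arbitrary (there (here refl)))
  assumption⊎segment (∨I₁ B i d₁ d₂)      = inj₂ (segment-via-arbitrary (there (here refl)))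
  assumption⊎segment (∨I₂ A i d₁ d₂)      = inj₂ (segment-via-arbitrary (there (here refl)))
  assumption⊎segment (∨E i j d₁ d₂ d₃)    = inj₂ (segment-via-arbitrary (there (here refl)))
  assumption⊎segment (⊃I A i d₁ d₂)       = inj₂ (segment-via-arbitrary (there (here refl)))
  assumption⊎segment (TR A B i j d₁ d₂)   = inj₂ (segment-via-arbitrary (here refl))
  assumption⊎segment (⊃E i d₁ d₂ d₃)      = inj₂ (segment-via-arbitrary (there (there (here refl))))
  assumption⊎segment (¬I A i j d₁ d₂)     = inj₂ (segment-via-arbitrary (here refl))
  assumption⊎segment (∃I A t i d₁ d₂)     = inj₂ (segment-via-arbitrary (there (here refl)))
  assumption⊎segment (∃E a i d₁ d₂)       = inj₂ (segment-via-arbitrary (there (here refl)))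

  normal-majorPremise-assumption : ∀ {C M} {s : Ded C} {d : Ded M} → Normal s →
                                   majorPremise s ≡ just (M , d) → Σ ℕ λ m → d ≡ assume m M
  normal-majorPremise-assumption {s = s} {d} (_ , noMaxS) eq with assumption⊎segment d
  ... | inj₁ isAssumption = isAssumption
  ... | inj₂ seg          = ⊥-elim (noMaxS (maxs s d ⊑-refl eq seg))

  SubOfEither : Fm → Fm → Fm → Set
  SubOfEither C P X = Sub X C ⊎ Sub X P

  Principal : ∀ {C} → Ded C → Fm → Set
  Principal {C} s P =
    All (λ p → SubOfEither C P (fm p) × All (λ kG → SubOfEither C P (proj₂ kG)) (disch p))
        (premisesOf s)

  data Inference {C} (s : Ded C) (P : Fm) : Set where
    elim  : ∀ {d : Ded P} → prem P d false [] nothing ∈ premisesOf s →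
            majorPremise s ≡ just (P , d) → Principal s P → Inference s P
    intro : ∀ {t : Ded C} {i} → prem C t true ((i , P) ∷ []) (just i) ∈ premisesOf s →
            (NonVacuous s → Open t i P) → Principal s P → Inference s P

  inference : ∀ {C p} (s : Ded C) → p ∈ premisesOf s → Σ Fm (Inference s)
  inference (assume i A) ()
  inference (∧I {A} {B} i d₁ d₂ d₃) _ = A ∧ B ,
    intro (there (there (here refl))) (λ nv → nv _ (there (there (here refl))) i _ (here refl))
      ((inj₂ (sub-∧ˡ sub-refl) , []) ∷ (inj₂ (sub-∧ʳ sub-refl) , []) ∷
       (inj₁ sub-refl , inj₂ sub-refl ∷ []) ∷ [])
  inference (∨I₁ {A} B i d₁ d₂) _ = A ∨ B ,
    intro (there (here refl)) (λ nv → nv _ (there (here refl)) i _ (here refl))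
      ((inj₂ (sub-∨ˡ sub-refl) , []) ∷ (inj₁ sub-refl , inj₂ sub-refl ∷ []) ∷ [])
  inference (∨I₂ {B} A i d₁ d₂) _ = A ∨ B ,
    intro (there (here refl)) (λ nv → nv _ (there (here refl)) i _ (here refl))
      ((inj₂ (sub-∨ʳ sub-refl) , []) ∷ (inj₁ sub-refl , inj₂ sub-refl ∷ []) ∷ [])
  inference (⊃I {B} A i d₁ d₂) _ = A ⊃ B ,
    intro (there (here refl)) (λ nv → nv _ (there (here refl)) i _ (here refl))
      ((inj₂ (sub-⊃ʳ sub-refl) , []) ∷ (inj₁ sub-refl , inj₂ sub-refl ∷ []) ∷ [])
  inference (TR A B i j d₁ d₂) _ = A ⊃ B ,
    intro (there (here refl)) (λ nv → nv _ (there (here refl)) j _ (here refl))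
      ((inj₁ sub-refl , inj₂ (sub-⊃ˡ sub-refl) ∷ []) ∷ (inj₁ sub-refl , inj₂ sub-refl ∷ []) ∷ [])
  inference (¬I A i j d₁ d₂) _ = ¬' A ,
    intro (there (here refl)) (λ nv → nv _ (there (here refl)) j _ (here refl))
      ((inj₁ sub-refl , inj₂ (sub-¬ sub-refl) ∷ []) ∷ (inj₁ sub-refl , inj₂ sub-refl ∷ []) ∷ [])
  inference (∃I A t i d₁ d₂) _ = ∃' A ,
    intro (there (here refl)) (λ nv → nv _ (there (here refl)) i _ (here refl))
      ((inj₂ (sub-∃ t sub-refl) , []) ∷ (inj₁ sub-refl , inj₂ sub-refl ∷ []) ∷ [])
  inference (∧E {A} {B} i j d₁ d₂) _ = A ∧ B ,
    elim (here refl) refl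
      ((inj₂ sub-refl , []) ∷
       (inj₁ sub-refl , inj₂ (sub-∧ˡ sub-refl) ∷ inj₂ (sub-∧ʳ sub-refl) ∷ []) ∷ [])
  inference (∨E {A} {B} i j d₁ d₂ d₃) _ = A ∨ B ,
    elim (here refl) refl
      ((inj₂ sub-refl , []) ∷ (inj₁ sub-refl , inj₂ (sub-∨ˡ sub-refl) ∷ []) ∷
       (inj₁ sub-refl , inj₂ (sub-∨ʳ sub-refl) ∷ []) ∷ [])
  inference (⊃E {A} {B} i d₁ d₂ d₃) _ = A ⊃ B ,
    elim (here refl) refl
      ((inj₂ sub-refl , []) ∷ (inj₂ (sub-⊃ˡ sub-refl) , []) ∷
       (inj₁ sub-refl , inj₂ (sub-⊃ʳ sub-refl) ∷ []) ∷ [])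
  inference (¬E {A} C d₁ d₂) _ = ¬' A ,
    elim (here refl) refl ((inj₂ sub-refl , []) ∷ (inj₂ (sub-¬ sub-refl) , []) ∷ [])
  inference (∃E {A} a i d₁ d₂) _ = ∃' A ,
    elim (here refl) refl
      ((inj₂ sub-refl , []) ∷ (inj₁ sub-refl , inj₂ (sub-∃ (par a) sub-refl) ∷ []) ∷ [])

  principal : ∀ {C P} {s : Ded C} → Inference s P → Principal s P
  principal (elim _ _ pr)  = pr
  principal (intro _ _ pr) = pr

  Covered : ∀ {C} → Ded C → Fm → Set
  Covered {C} s X =
    Sub X C ⊎ Σ ℕ λ k → Σ Fm λ G → Open s k G × OpenMajorAss s k × Sub X G

  covered-sub : ∀ {C X Y} {s : Ded C} → Sub X Y → Covered s Y → Covered s X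
  covered-sub x≤y (inj₁ y≤C)                   = inj₁ (sub-trans x≤y y≤C)
  covered-sub x≤y (inj₂ (k , G , o , m , y≤G)) = inj₂ (k , G , o , m , sub-trans x≤y y≤G)

  covered-subOfEither : ∀ {C P X} {s : Ded C} → Covered s P → SubOfEither C P X → Covered s X
  covered-subOfEither _   (inj₁ x≤C) = inj₁ x≤C
  covered-subOfEither cov (inj₂ x≤P) = covered-sub x≤P cov

  covered-premise : ∀ {C P X p} {s : Ded C} → Consistent s → p ∈ premisesOf s →
                    Principal s P → Covered s P → Covered (sub p) X → Covered s X
  covered-premise _ mem pr cov (inj₁ x≤fm) =
    covered-sub x≤fm (covered-subOfEither cov (proj₁ (lookup pr mem)))
  covered-premise {p = p} cons mem pr cov (inj₂ (k , G , o , m , x≤G))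
    with k ∈? map proj₁ (disch p)
  ... | no ¬disch = inj₂ (k , G , open-prem p mem ¬disch o , there p mem ¬disch m , x≤G)
  ... | yes disch with ∈-map⁻ proj₁ disch
  ...   | (_ , Y) , kY∈ , refl =
    covered-sub (subst (Sub _) (cons p mem k Y kY∈ G o) x≤G)
                (covered-subOfEither cov (lookup (proj₂ (lookup pr mem)) kY∈))

  mutual
    covered : ∀ {C F} {s : Ded C} {e : Ded F} → WF s → Normal s → e ⊑ s → Covered s F
    covered _ _ ⊑-refl = inj₁ sub-refl
    covered {s = s} (wf ws cons nv eig) n (⊑-prem p mem e⊑) =
      covered-premise cons mem (principal inf) (covered-principal (wf ws cons nv eig) n inf)
        (covered (ws p mem) (normal-premise n mem) e⊑)
      where
      inf : Inference s (proj₁ (inference s mem))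
      inf = proj₂ (inference s mem)

    covered-principal : ∀ {C P} {s : Ded C} → WF s → Normal s → Inference s P → Covered s P
    covered-principal _ n (elim mem eq _) with normal-majorPremise-assumption n eq
    ... | m , refl =
      inj₂ (m , _ , open-prem _ mem (λ ()) (open-assume m _) , here eq , sub-refl)
    covered-principal {s = s} (wf ws _ nv _) n (intro {i = i} mem occurs _)
      with covered (ws _ mem) (normal-premise n mem) (open⇒⊑ (occurs nv))
    ... | inj₁ P≤C = inj₁ P≤C
    ... | inj₂ (k , G , o , m , P≤G) =
      inj₂ (k , G , open-prem _ mem undischarged o , there _ mem undischarged m , P≤G)
      where
      undischarged : ¬ (k ∈ i ∷ [])
      undischarged (here refl) = proj₁ n (maxf s _ i ⊑-refl mem refl m)

corollary6 : (S : Signature) → let open ND S in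
    ∀ {C} (d : Ded C) → WF d → Normal d →
    ∀ {F} (e : Ded F) → e ⊑ d →
    Sub F C ⊎ (Σ ℕ λ i → Σ Fm λ G → Open d i G × Sub F G)
corollary6 S d w n e e⊑d =
  map₂ (λ { (k , G , o , _ , F≤G) → k , G , o , F≤G })
       (SubformulaProperty.covered S w n e⊑d)
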